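{- Let $\mathcal{A}=A_1\times\cdots\times A_m$ (finite nonempty sets $A_i$ with $A_i=A_{m-i+1}$). If $H\subseteq\bar{\mathcal{A}}$ is symmetric and prefix-free, then $H=\bigcup_{i=1}^kH_i$ for some $H_1,\dots,H_k\subseteq H$, each minimal symmetric, with $H_i\cap H_j=\varnothing$ for $i\ne j$.
   Context: $\bar{\mathcal{A}}=\bigcup_{i=0}^m A_1\times\cdots\times A_i$ (with the empty tuple for $i=0$). For $\vec a\in\bar{\mathcal{A}}$ of length $\ell$ we also write $\vec a$ for the set $\{\vec a\}\times A_{\ell+1}\times\cdots\times A_m\subseteq\mathcal{A}$. $\vec a$ is a prefix of $\vec b$ if $|\vec a|\le|\vec b|$ and the first $|\vec a|$ entries of $\vec b$ equal $\vec a$; $J\subseteq\bar{\mathcal{A}}$ is prefix-free if whenever $\vec a,\vec b\in J$ and $\vec a$ is a prefix of $\vec b$ then $\vec a=\vec b$. For $\vec a=(a_1,\dots,a_\ell)$, the reverse set is $\overleftarrow{a}=A_1\times\cdots\times A_{m-\ell}\times\{a_\ell\}\times\cdots\times\{a_1\}\subseteq\mathcal{A}$; for $H\subseteq\bar{\mathcal{A}}$, $\cup H=\bigcup_{\vec h\in H}\vec h$ and $\cup H_{\mathrm{rev}}=\bigcup_{\vec h\in H}\overleftarrow{h}$. $H$ is symmetric if $\cup H=\cup H_{\mathrm{rev}}$, and minimal symmetric if it is symmetric and no nonempty proper subset of $H$ is symmetric. -}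

module Defs where

open import Data.Nat using (ℕ; _<_)
open import Data.List using (List; []; _∷_; _++_; reverse; length; lookup)
open import Data.List.Membership.Propositional using (_∈_)
open import Data.List.Relation.Binary.Pointwise using (Pointwise)
open import Data.List.Relation.Binary.Prefix.Heterogeneous using (Prefix)
open import Data.Product using (Σ; ∃; _×_; _,_)
open import Data.Fin using (Fin)
open import Data.Empty using (⊥)
open import Relation.Binary.PropositionalEquality using (_≡_; _≢_)
open import Relation.Nullary using (¬_)
open import Level using (0ℓ)

-- Convention: the factor A_i is encoded as {0, …, sᵢ - 1} ⊆ ℕ, where
-- `sizes = s₁ ∷ … ∷ sₘ`, so m = length sizes.  Equal sets A_i = A_{m-i+1}
-- get the same encoding (sizes are a palindrome).

Tuple : Set
Tuple = List ℕ

InA : List ℕ → Tuple → Set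
InA sizes x = Pointwise _<_ x sizes

-- a ∈ Ā = ⋃_{i=0}^m A₁ × ⋯ × A_i
InAbar : List ℕ → Tuple → Set
InAbar sizes a = Prefix _<_ a sizes

_≼_ : Tuple → Tuple → Set
a ≼ b = ∃ λ c → b ≡ a ++ c

-- x ∈ a (as the subset {a} × A_{ℓ+1} × ⋯ × Aₘ of 𝒜), for x ∈ 𝒜
InCyl : Tuple → Tuple → Set
InCyl a x = ∃ λ c → x ≡ a ++ c

-- x ∈ ←a = A₁ × ⋯ × A_{m-ℓ} × {a_ℓ} × ⋯ × {a₁}, for x ∈ 𝒜
InRev : Tuple → Tuple → Set
InRev a x = ∃ λ y → x ≡ y ++ reverse a

-- finite subsets of Ā are represented by lists (membership semantics)
Coll : Set
Coll = List Tuple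

_⊆_ : Coll → Coll → Set
P ⊆ H = ∀ {h} → h ∈ P → h ∈ H

InUnion : Coll → Tuple → Set
InUnion H x = ∃ λ h → h ∈ H × InCyl h x

InUnionRev : Coll → Tuple → Set
InUnionRev H x = ∃ λ h → h ∈ H × InRev h x

Symmetric : List ℕ → Coll → Set
Symmetric sizes H =
  ∀ x → InA sizes x → (InUnion H x → InUnionRev H x) × (InUnionRev H x → InUnion H x)

PrefixFree : Coll → Set
PrefixFree H = ∀ {a b} → a ∈ H → b ∈ H → a ≼ b → a ≡ b

NonemptyProperSubset : Coll → Coll → Set
NonemptyProperSubset P H = P ⊆ H × (∃ λ p → p ∈ P) × (∃ λ h → h ∈ H × ¬ (h ∈ P))

MinimalSymmetric : List ℕ → Coll → Set
MinimalSymmetric sizes H =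
  Symmetric sizes H × (∀ P → NonemptyProperSubset P H → ¬ Symmetric sizes P)

UnionIs : List Coll → Coll → Set
UnionIs Hs H = ∀ h → (h ∈ H → ∃ λ Hi → Hi ∈ Hs × h ∈ Hi) × ((∃ λ Hi → Hi ∈ Hs × h ∈ Hi) → h ∈ H)

PairwiseDisjoint : List Coll → Set
PairwiseDisjoint Hs = ∀ (i j : Fin (length Hs)) → i ≢ j →
  ∀ h → h ∈ lookup Hs i → h ∈ lookup Hs j → ⊥

-- Repeatedly split off symmetric pieces.  If a symmetric, prefix-free H has a
-- nonempty proper symmetric subset S, then H ∖ S is symmetric too: by
-- prefix-freeness a point of 𝒜 lies in the cylinder of at most one member of H
-- and in the reversed cylinder of at most one member, so a point covered by
-- H ∖ S cannot have its reverse cover in S, or the symmetry of S would put it in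
-- a cylinder of S as well.  Induction on |H| decomposes both parts; when no such
-- S exists, H itself is minimal symmetric, and which case holds is decidable
-- because 𝒜 and the sublists of H are finite.
module Submission where

open import Defs
open import Data.Nat using (ℕ; _<_; suc; s≤s)
import Data.Nat as ℕ
open import Data.Nat.Properties using (<-≤-trans; ≤-refl; allUpTo?)
open import Data.List using (List; []; _∷_; [_]; _++_; map; filter; length; lookup; reverse)
open import Data.List.Properties using (≡-dec; ∷-injective; reverse-++; reverse-involutive; filter-notAll)
open import Data.List.Relation.Unary.All as All using (All; []; _∷_)
import Data.List.Relation.Unary.All.Properties as All
open import Data.List.Relation.Unary.AllPairs using (AllPairs; []; _∷_)
import Data.List.Relation.Unary.AllPairs.Properties as AllPairs
open import Data.List.Relation.Unary.Any using (here; there; any?)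
open import Data.List.Relation.Binary.Pointwise using ([]; _∷_)
open import Data.List.Relation.Binary.Disjoint.Propositional using (Disjoint)
import Data.List.Relation.Binary.Disjoint.Propositional.Properties as Disjoint
open import Data.List.Membership.Propositional using (_∈_; find; lose)
open import Data.List.Membership.Propositional.Properties
  using (∈-map⁺; ∈-map⁻; ∈-++⁺ˡ; ∈-++⁺ʳ; ∈-++⁻; ∈-filter⁺; ∈-filter⁻; ∈-lookup)
open import Data.List.Relation.Binary.Subset.Propositional.Properties using (filter-⊆)
open import Data.Product using (∃; _×_; _,_; proj₁; proj₂)
open import Data.Sum using (_⊎_; inj₁; inj₂)
open import Data.Empty using (⊥-elim)
open import Data.Fin using (zero; suc)
open import Function using (_∘_; _$_; id)
open import Relation.Nullary using (¬_; Dec; yes; no; ¬?)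
open import Relation.Nullary.Decidable using (map′; _×-dec_; _→-dec_)
open import Level using (0ℓ)
open import Relation.Unary using (Pred; Decidable)
open import Relation.Binary.PropositionalEquality using (_≡_; _≢_; refl; sym; trans; cong)

_≟ᵗ_ : (a b : Tuple) → Dec (a ≡ b)
_≟ᵗ_ = ≡-dec ℕ._≟_

open import Data.List.Membership.DecPropositional _≟ᵗ_ using (_∈?_)

inCyl? : (a x : Tuple) → Dec (InCyl a x)
inCyl? []      x       = yes (x , refl)
inCyl? (i ∷ a) []      = no λ { (_ , ()) }
inCyl? (i ∷ a) (j ∷ x) with i ℕ.≟ j | inCyl? a x
... | yes refl | yes (c , x≡a++c) = yes (c , cong (i ∷_) x≡a++c)
... | yes refl | no  x∉a          = no λ { (c , e) → x∉a (c , proj₂ (∷-injective e)) }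
... | no  i≢j  | _                = no λ { (c , e) → i≢j (sym (proj₁ (∷-injective e))) }

InRev⇒InCyl-reverse : ∀ {a x} → InRev a x → InCyl a (reverse x)
InRev⇒InCyl-reverse {a} (y , refl) =
  reverse y , trans (reverse-++ y (reverse a)) (cong (_++ reverse y) (reverse-involutive a))

InCyl-reverse⇒InRev : ∀ {a x} → InCyl a (reverse x) → InRev a x
InCyl-reverse⇒InRev {a} {x} (c , e) =
  reverse c , trans (sym (reverse-involutive x)) (trans (cong reverse e) (reverse-++ a c))

inRev? : (a x : Tuple) → Dec (InRev a x)
inRev? a x = map′ InCyl-reverse⇒InRev InRev⇒InCyl-reverse (inCyl? a (reverse x))

∃∈? : ∀ {A : Set} {P : Pred A 0ℓ} → Decidable P → (xs : List A) → Dec (∃ λ x → x ∈ xs × P x)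
∃∈? P? xs = map′ find (λ { (_ , x∈xs , px) → lose x∈xs px }) (any? P? xs)

∀InA? : ∀ sizes {Q : Pred Tuple 0ℓ} → Decidable Q → Dec (∀ x → InA sizes x → Q x)
∀InA? []       Q? = map′ (λ { q [] [] → q }) (λ f → f [] []) (Q? [])
∀InA? (s ∷ ss) Q? =
  map′ (λ { f (_ ∷ x) (i<s ∷ x∈) → f i<s x x∈ }) (λ f {i} i<s x x∈ → f (i ∷ x) (i<s ∷ x∈))
       (allUpTo? (λ i → ∀InA? ss (Q? ∘ (i ∷_))) s)

symmetric? : ∀ sizes H → Dec (Symmetric sizes H)
symmetric? sizes H = ∀InA? sizes λ x →
  (inUnion? x →-dec inUnionRev? x) ×-dec (inUnionRev? x →-dec inUnion? x)
  where
  inUnion? inUnionRev? : ∀ x → Dec _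
  inUnion?    x = ∃∈? (λ h → inCyl? h x) H
  inUnionRev? x = ∃∈? (λ h → inRev? h x) H

symmetric-resp-⊆⊇ : ∀ {sizes P Q} → P ⊆ Q → Q ⊆ P → Symmetric sizes P → Symmetric sizes Q
symmetric-resp-⊆⊇ {P = P} {Q} P⊆Q Q⊆P symP x x∈𝒜 =
  move {InCyl} {InRev} (proj₁ (symP x x∈𝒜)) , move {InRev} {InCyl} (proj₂ (symP x x∈𝒜))
  where
  move : ∀ {C D : Tuple → Tuple → Set} →
    ((∃ λ h → h ∈ P × C h x) → ∃ λ h → h ∈ P × D h x) →
    (∃ λ h → h ∈ Q × C h x) → ∃ λ h → h ∈ Q × D h x
  move P-C⇒D (h , h∈Q , Chx) =
    let (h′ , h′∈P , Dh′x) = P-C⇒D (h , Q⊆P h∈Q , Chx) in h′ , P⊆Q h′∈P , Dh′x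

prefixFree-⊆ : ∀ {P H} → P ⊆ H → PrefixFree H → PrefixFree P
prefixFree-⊆ P⊆H pfH a∈P b∈P = pfH (P⊆H a∈P) (P⊆H b∈P)

++-prefixes-comparable : ∀ a b {c d : Tuple} → a ++ c ≡ b ++ d → a ≼ b ⊎ b ≼ a
++-prefixes-comparable []      b       _ = inj₁ (b , refl)
++-prefixes-comparable (i ∷ a) []      _ = inj₂ (i ∷ a , refl)
++-prefixes-comparable (i ∷ a) (j ∷ b) e with ∷-injective e
... | refl , e′ with ++-prefixes-comparable a b e′
...   | inj₁ (c , b≡a++c) = inj₁ (c , cong (i ∷_) b≡a++c)
...   | inj₂ (c , a≡b++c) = inj₂ (c , cong (i ∷_) a≡b++c)

prefixFree-InCyl-unique : ∀ {H a b x} → PrefixFree H → a ∈ H → b ∈ H →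
  InCyl a x → InCyl b x → a ≡ b
prefixFree-InCyl-unique pfH a∈H b∈H (c , x≡a++c) (d , x≡b++d)
  with ++-prefixes-comparable _ _ (trans (sym x≡a++c) x≡b++d)
... | inj₁ a≼b = pfH a∈H b∈H a≼b
... | inj₂ b≼a = sym (pfH b∈H a∈H b≼a)

prefixFree-InRev-unique : ∀ {H a b x} → PrefixFree H → a ∈ H → b ∈ H →
  InRev a x → InRev b x → a ≡ b
prefixFree-InRev-unique pfH a∈H b∈H x∈←a x∈←b =
  prefixFree-InCyl-unique pfH a∈H b∈H (InRev⇒InCyl-reverse x∈←a) (InRev⇒InCyl-reverse x∈←b)

_∩_ : Coll → Coll → Coll
H ∩ S = filter (_∈? S) H

_∖_ : Coll → Coll → Coll
H ∖ S = filter (¬? ∘ (_∈? S)) H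

∩-symmetric : ∀ {sizes H S} → S ⊆ H → Symmetric sizes S → Symmetric sizes (H ∩ S)
∩-symmetric {H = H} {S} S⊆H =
  symmetric-resp-⊆⊇ (λ h∈S → ∈-filter⁺ (_∈? S) (S⊆H h∈S) h∈S) (proj₂ ∘ ∈-filter⁻ (_∈? S) {xs = H})

∖-symmetric : ∀ {sizes H S} → PrefixFree H → Symmetric sizes H → S ⊆ H → Symmetric sizes S →
  Symmetric sizes (H ∖ S)
∖-symmetric {sizes} {H} {S} pfH symH S⊆H symS x x∈𝒜 =
  transfer {InCyl} {InRev} (proj₁ (symH x x∈𝒜)) (proj₂ (symS x x∈𝒜)) (prefixFree-InCyl-unique pfH) ,
  transfer {InRev} {InCyl} (proj₂ (symH x x∈𝒜)) (proj₁ (symS x x∈𝒜)) (prefixFree-InRev-unique pfH)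
  where
  transfer : ∀ {C D : Tuple → Tuple → Set} →
    ((∃ λ h → h ∈ H × C h x) → ∃ λ h → h ∈ H × D h x) →
    ((∃ λ h → h ∈ S × D h x) → ∃ λ h → h ∈ S × C h x) →
    (∀ {a b} → a ∈ H → b ∈ H → C a x → C b x → a ≡ b) →
    (∃ λ h → h ∈ H ∖ S × C h x) → ∃ λ h → h ∈ H ∖ S × D h x
  transfer H-C⇒D S-D⇒C C-unique (r , r∈H∖S , Crx) with ∈-filter⁻ (¬? ∘ (_∈? S)) {xs = H} r∈H∖S
  ... | r∈H , r∉S with H-C⇒D (r , r∈H , Crx)
  ...   | h , h∈H , Dhx with h ∈? S
  ...     | no  h∉S = h , ∈-filter⁺ (¬? ∘ (_∈? S)) h∈H h∉S , Dhx
  ...     | yes h∈S with S-D⇒C (h , h∈S , Dhx)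
  ...       | p , p∈S , Cpx with C-unique (S⊆H p∈S) r∈H Cpx Crx
  ...         | refl = ⊥-elim (r∉S p∈S)

nonempty? : ∀ {A : Set} (xs : List A) → Dec (∃ λ x → x ∈ xs)
nonempty? []      = no λ { (_ , ()) }
nonempty? (x ∷ _) = yes (x , here refl)

sublists : ∀ {A : Set} → List A → List (List A)
sublists []       = [ [] ]
sublists (x ∷ xs) = map (x ∷_) (sublists xs) ++ sublists xs

∈-sublists⇒⊆ : ∀ {A : Set} (xs : List A) {ys} → ys ∈ sublists xs → ∀ {y} → y ∈ ys → y ∈ xs
∈-sublists⇒⊆ []       (here refl) ()
∈-sublists⇒⊆ (x ∷ xs) ys∈ with ∈-++⁻ (map (x ∷_) (sublists xs)) ys∈
... | inj₂ ys∈′ = there ∘ ∈-sublists⇒⊆ xs ys∈′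
... | inj₁ x∷zs∈ with ∈-map⁻ (x ∷_) x∷zs∈
...   | zs , zs∈ , refl = λ { (here refl) → here refl ; (there y∈zs) → there (∈-sublists⇒⊆ xs zs∈ y∈zs) }

filter∈sublists : ∀ {A : Set} {P : Pred A 0ℓ} (P? : Decidable P) xs → filter P? xs ∈ sublists xs
filter∈sublists P? []       = here refl
filter∈sublists P? (x ∷ xs) with P? x
... | yes _ = ∈-++⁺ˡ (∈-map⁺ (x ∷_) (filter∈sublists P? xs))
... | no  _ = ∈-++⁺ʳ (map (x ∷_) (sublists xs)) (filter∈sublists P? xs)

allPairs-lookup : ∀ {A : Set} {R : A → A → Set} {xs} → (∀ {x y} → R x y → R y x) →
  AllPairs R xs → ∀ i j → i ≢ j → R (lookup xs i) (lookup xs j)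
allPairs-lookup R-sym (_  ∷ _)   zero    zero    i≢j = ⊥-elim (i≢j refl)
allPairs-lookup R-sym (Rx ∷ _)   zero    (suc j) _   = All.lookup Rx (∈-lookup j)
allPairs-lookup R-sym (Rx ∷ _)   (suc i) zero    _   = R-sym (All.lookup Rx (∈-lookup i))
allPairs-lookup R-sym (_  ∷ Rxs) (suc i) (suc j) i≢j = allPairs-lookup R-sym Rxs i j (i≢j ∘ cong suc)

module _ (sizes : List ℕ) where

  SymmetricSplit : Coll → Set
  SymmetricSplit H = ∃ λ S → NonemptyProperSubset S H × Symmetric sizes S

  -- NonemptyProperSubset without the inclusion S ⊆ H, which every member of
  -- sublists H satisfies; unlike that inclusion, this is decidable as stated.
  SplitCandidate : Coll → Coll → Set
  SplitCandidate H S = (∃ λ p → p ∈ S) × Symmetric sizes S × (∃ λ h → h ∈ H × ¬ h ∈ S)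

  splitCandidate? : ∀ H → Decidable (SplitCandidate H)
  splitCandidate? H S = nonempty? S ×-dec symmetric? sizes S ×-dec ∃∈? (¬? ∘ (_∈? S)) H

  minimal-or-split : ∀ {H} → Symmetric sizes H → MinimalSymmetric sizes H ⊎ SymmetricSplit H
  minimal-or-split {H} symH with ∃∈? (splitCandidate? H) (sublists H)
  ... | yes (S , S∈ , S≢∅ , symS , H⊈S) = inj₂ (S , (∈-sublists⇒⊆ H S∈ , S≢∅ , H⊈S) , symS)
  ... | no ¬candidate = inj₁ (symH , minimal)
    where
    minimal : ∀ P → NonemptyProperSubset P H → ¬ Symmetric sizes P
    minimal P (P⊆H , (p , p∈P) , (h , h∈H , h∉P)) symP =
      ¬candidate (H ∩ P , filter∈sublists (_∈? P) H ,
                  (p , ∈-filter⁺ (_∈? P) (P⊆H p∈P) p∈P) ,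
                  ∩-symmetric P⊆H symP ,
                  (h , h∈H , h∉P ∘ proj₂ ∘ ∈-filter⁻ (_∈? P) {xs = H}))

  Decomposition : Coll → Set
  Decomposition H = ∃ λ (Hs : List Coll) →
    All (λ Hi → Hi ⊆ H × MinimalSymmetric sizes Hi) Hs × UnionIs Hs H × AllPairs Disjoint Hs

  minimal⇒decomposition : ∀ {H} → MinimalSymmetric sizes H → Decomposition H
  minimal⇒decomposition {H} minH = [ H ] , (id , minH) ∷ [] , union , [] ∷ []
    where
    union : UnionIs [ H ] H
    union h = (λ h∈H → H , here refl , h∈H) , λ { (_ , here refl , h∈H) → h∈H }

  decomposition-filter : ∀ {P : Pred Tuple 0ℓ} (P? : Decidable P) H →
    Decomposition (filter P? H) → Decomposition (filter (¬? ∘ P?) H) → Decomposition H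
  decomposition-filter P? H (Hs₁ , pieces₁ , union₁ , disj₁) (Hs₂ , pieces₂ , union₂ , disj₂) =
    Hs₁ ++ Hs₂ ,
    All.++⁺ (All.map (weaken P?) pieces₁) (All.map (weaken (¬? ∘ P?)) pieces₂) ,
    union ,
    AllPairs.++⁺ disj₁ disj₂ separated
    where
    separated : All (λ Hi → All (Disjoint Hi) Hs₂) Hs₁
    separated = All.tabulate λ Hi∈ → All.tabulate λ Hj∈ (h∈Hi , h∈Hj) →
      proj₂ (∈-filter⁻ (¬? ∘ P?) {xs = H} (proj₁ (All.lookup pieces₂ Hj∈) h∈Hj))
            (proj₂ (∈-filter⁻ P? {xs = H} (proj₁ (All.lookup pieces₁ Hi∈) h∈Hi)))

    weaken : ∀ {Q : Pred Tuple 0ℓ} (Q? : Decidable Q) {Hi} →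
      Hi ⊆ filter Q? H × MinimalSymmetric sizes Hi → Hi ⊆ H × MinimalSymmetric sizes Hi
    weaken Q? (Hi⊆ , minHi) = filter-⊆ Q? H ∘ Hi⊆ , minHi

    union : UnionIs (Hs₁ ++ Hs₂) H
    union h = covered , (λ { (Hi , Hi∈ , h∈Hi) → inside (∈-++⁻ Hs₁ Hi∈) h∈Hi })
      where
      covered : h ∈ H → ∃ λ Hi → Hi ∈ Hs₁ ++ Hs₂ × h ∈ Hi
      covered h∈H with P? h
      ... | yes Ph = let (Hi , Hi∈ , h∈Hi) = proj₁ (union₁ h) (∈-filter⁺ P? h∈H Ph)
                     in Hi , ∈-++⁺ˡ Hi∈ , h∈Hi
      ... | no ¬Ph = let (Hi , Hi∈ , h∈Hi) = proj₁ (union₂ h) (∈-filter⁺ (¬? ∘ P?) h∈H ¬Ph)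
                     in Hi , ∈-++⁺ʳ Hs₁ Hi∈ , h∈Hi
      inside : ∀ {Hi} → Hi ∈ Hs₁ ⊎ Hi ∈ Hs₂ → h ∈ Hi → h ∈ H
      inside (inj₁ Hi∈) h∈Hi = filter-⊆ P? H (proj₂ (union₁ h) (_ , Hi∈ , h∈Hi))
      inside (inj₂ Hi∈) h∈Hi = filter-⊆ (¬? ∘ P?) H (proj₂ (union₂ h) (_ , Hi∈ , h∈Hi))

  decompose : ∀ n H → length H < n → Symmetric sizes H → PrefixFree H → Decomposition H
  decompose (suc n) H (s≤s |H|≤n) symH pfH with minimal-or-split symH
  ... | inj₁ minH = minimal⇒decomposition minH
  ... | inj₂ (S , (S⊆H , (p , p∈S) , (h , h∈H , h∉S)) , symS) =
    decomposition-filter (_∈? S) H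
      (decompose n (H ∩ S) (<-≤-trans |H∩S|<|H| |H|≤n)
                 (∩-symmetric S⊆H symS) (prefixFree-⊆ (filter-⊆ (_∈? S) H) pfH))
      (decompose n (H ∖ S) (<-≤-trans |H∖S|<|H| |H|≤n)
                 (∖-symmetric pfH symH S⊆H symS) (prefixFree-⊆ (filter-⊆ (¬? ∘ (_∈? S)) H) pfH))
    where
    |H∩S|<|H| : length (H ∩ S) < length H
    |H∩S|<|H| = filter-notAll (_∈? S) H (lose h∈H h∉S)

    |H∖S|<|H| : length (H ∖ S) < length H
    |H∖S|<|H| = filter-notAll (¬? ∘ (_∈? S)) H (lose (S⊆H p∈S) (_$ p∈S))

proposition7p6 : (sizes : List ℕ) → All (λ n → 0 < n) sizes → reverse sizes ≡ sizes →
    (H : Coll) → All (InAbar sizes) H → Symmetric sizes H → PrefixFree H →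
    ∃ λ (Hs : List Coll) →
    All (λ Hi → Hi ⊆ H × MinimalSymmetric sizes Hi) Hs × UnionIs Hs H × PairwiseDisjoint Hs
proposition7p6 sizes _ _ H _ symH pfH with decompose sizes (suc (length H)) H ≤-refl symH pfH
... | Hs , pieces , union , disjoint =
  Hs , pieces , union , λ i j i≢j h h∈Hsᵢ h∈Hsⱼ →
    allPairs-lookup Disjoint.sym disjoint i j i≢j (h∈Hsᵢ , h∈Hsⱼ)
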